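{- Let $s$ be a non-leaping sequence, $G\in\mathrm{CP}(s)$ the graph of a neighborhood sequence $W_1,\ldots,W_n$ (with associated $a_k$), and $\mathcal{D}$ its distance matrix. For $k\ge 3$ let ${\bf b}=\mathcal{D}({\bf e}_k-{\bf e}_{a_k}-{\bf e}_{k-1}+{\bf e}_{a_{k-1}})$. Then for $h\le k$: ${\bf b}_h=0$ if $h<b_{k-1}$; ${\bf b}_h=1$ if $b_{k-1}\le h<b_k$; ${\bf b}_h=0$ if $b_k\le h<k-1$; ${\bf b}_{k-1}=1$; ${\bf b}_k=-1$ if $a_{k-1}=a_k$; and ${\bf b}_k=0$ if $a_{k-1}<a_k$.
   Context: A sequence of integers $q_1,\ldots,q_n$ ($n\ge 2$) is non-leaping if $q_1=0$, $q_2=1$, and $2\le q_k\le q_{k-1}+1$ for $k=3,\ldots,n$. Set $b_k=k-q_k+1$ for $k\ge 3$, and $a_2=1$, $b_2=2$. A neighborhood sequence is $W_1=\varnothing$, $W_2=\{1\}$, and for $k\ge3$, $W_k=\{a_k\}\cup\{b_k,\ldots,k-1\}$ where $a_k\in W_{k-1}$ and $a_k<b_k$. Its graph has vertex set $\{1,\ldots,n\}$ and edges $\{i,k\}$ for $i\in W_k$; $\mathrm{CP}(s)$ is the set of all such graphs. $\mathcal{D}=[\operatorname{dist}_G(i,j)]$, ${\bf e}_i$ are standard basis vectors, and ${\bf b}_h$ is the $h$-th entry. -}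

module Defs where

open import Data.Nat using (ℕ; zero; suc; _+_; _∸_; _≤_; _<_)
open import Data.Integer as ℤ using (ℤ; +_)
open import Data.Product using (_×_)
open import Data.Sum using (_⊎_)
open import Relation.Binary.PropositionalEquality using (_≡_)

-- Sequences are indexed by ℕ; only the entries at positions 1..n matter.

NonLeaping : ℕ → (ℕ → ℕ) → Set
NonLeaping n q =
  q 1 ≡ 0 × q 2 ≡ 1 ×
  (∀ k → 3 ≤ k → k ≤ n → 2 ≤ q k × q k ≤ q (k ∸ 1) + 1)

bseq : (ℕ → ℕ) → ℕ → ℕ
bseq q 0 = 0
bseq q 1 = 0
bseq q 2 = 2
bseq q k@(suc (suc (suc _))) = (k + 1) ∸ q k

-- InW q a i k  :  i ∈ W_k  (W_1 = ∅, W_2 = {1}, W_k = {a_k} ∪ {b_k,…,k-1}).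
InW : (ℕ → ℕ) → (ℕ → ℕ) → ℕ → ℕ → Set
InW q a i 0 = Data.Empty.⊥ where import Data.Empty
InW q a i 1 = Data.Empty.⊥ where import Data.Empty
InW q a i 2 = i ≡ 1
InW q a i k@(suc (suc (suc _))) = i ≡ a k ⊎ (bseq q k ≤ i × i < k)

NeighborhoodSeq : ℕ → (ℕ → ℕ) → (ℕ → ℕ) → Set
NeighborhoodSeq n q a =
  a 2 ≡ 1 ×
  (∀ k → 3 ≤ k → k ≤ n → InW q a (a k) (k ∸ 1) × a k < bseq q k)

Adj : ℕ → (ℕ → ℕ) → (ℕ → ℕ) → ℕ → ℕ → Set
Adj n q a i j = (j ≤ n × InW q a i j) ⊎ (i ≤ n × InW q a j i)

data Walk (E : ℕ → ℕ → Set) : ℕ → ℕ → ℕ → Set where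
  here : ∀ {i} → Walk E i i 0
  step : ∀ {i j l m} → E i j → Walk E j l m → Walk E i l (suc m)

IsDist : (ℕ → ℕ → Set) → ℕ → ℕ → ℕ → Set
IsDist E i j d = Walk E i j d × (∀ m → Walk E i j m → d ≤ m)

IsDistMatrix : ℕ → (ℕ → ℕ → Set) → (ℕ → ℕ → ℕ) → Set
IsDistMatrix n E D = ∀ i j → 1 ≤ i → i ≤ n → 1 ≤ j → j ≤ n → IsDist E i j (D i j)

-- h-th entry of D (e_k - e_{a_k} - e_{k-1} + e_{a_{k-1}}).
bvec : (ℕ → ℕ → ℕ) → (ℕ → ℕ) → ℕ → ℕ → ℤ
bvec D a k h =
  ((+ D h k) ℤ.- (+ D h (a k))) ℤ.- (+ D h (k ∸ 1)) ℤ.+ (+ D h (a (k ∸ 1)))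

module Submission where

open import Defs
open import Data.Nat using (ℕ; _≤_; _<_; _∸_)
open import Data.Integer using (ℤ; +_; -[1+_])
open import Data.Product using (_×_)
open import Relation.Binary.PropositionalEquality using (_≡_)

open import Data.Nat using (zero; suc; _+_; z≤n; s≤s; _≤′_; ≤′-refl; ≤′-step)
open import Data.Nat.Properties
open import Data.Nat.Induction using (<-wellFounded)
open import Induction.WellFounded using (Acc; acc)
open import Data.Product using (∃-syntax; _,_; proj₁; proj₂)
open import Data.Sum using (_⊎_; inj₁; inj₂; [_,_]′)
open import Data.Empty using (⊥-elim)
open import Relation.Nullary using (¬_)
open import Relation.Binary.PropositionalEquality using (refl; sym; trans; cong; subst; _≢_)
open import Relation.Binary.Definitions using (tri<; tri≈; tri>)
import Data.Integer as ℤ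
open import Data.Integer.Tactic.RingSolver using (solve-∀)

-- Every W_v is a clique, and a vertex x ∈ W_v even lies in W_y for every larger y ∈ W_v.
-- Hence a shortest walk from v down to a vertex u < v may be assumed to leave v through
-- W_v, and no vertex of W_v is farther from u than v is.  For u < b_v the only member of
-- W_v below b_v is a_v, which lies in every other member's W, so d(u,v) = d(u,a_v) + 1.
-- Every entry of 𝐛 then reduces to this identity or to distances 0, 1, 2 inside the
-- cliques W_k, W_{k-1}.

[1+x]-x-[1+y]+y≡0 : ∀ x y → ((+ 1 ℤ.+ x) ℤ.- x) ℤ.- (+ 1 ℤ.+ y) ℤ.+ y ≡ + 0
[1+x]-x-[1+y]+y≡0 = solve-∀

[1+x]-x-1+1≡1 : ∀ x → ((+ 1 ℤ.+ x) ℤ.- x) ℤ.- + 1 ℤ.+ + 1 ≡ + 1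
[1+x]-x-1+1≡1 = solve-∀

module Walks {E : ℕ → ℕ → Set} where

  snoc : ∀ {i j l m} → Walk E i j m → E j l → Walk E i l (suc m)
  snoc here e = step e here
  snoc (step e w) e′ = step e (snoc w e′)

  reverse : (∀ {i j} → E i j → E j i) → ∀ {i j m} → Walk E i j m → Walk E j i m
  reverse _ here = here
  reverse sym (step e w) = snoc (reverse sym w) (sym e)

  walk-≥1 : ∀ {i j m} → i ≢ j → Walk E i j m → 1 ≤ m
  walk-≥1 i≢j here = ⊥-elim (i≢j refl)
  walk-≥1 _ (step _ _) = s≤s z≤n

  walk-≥2 : ∀ {i j m} → i ≢ j → ¬ E i j → Walk E i j m → 2 ≤ m
  walk-≥2 i≢j _ here = ⊥-elim (i≢j refl)
  walk-≥2 _ ¬e (step e here) = ⊥-elim (¬e e)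
  walk-≥2 _ _ (step _ (step _ _)) = s≤s (s≤s z≤n)

module BSeq {n : ℕ} {q : ℕ → ℕ} (nonLeaping : NonLeaping n q) where

  b : ℕ → ℕ
  b = bseq q

  2≤qₖ : ∀ {k} → 3 ≤ k → k ≤ n → 2 ≤ q k
  2≤qₖ {k} 3≤k k≤n = proj₁ (proj₂ (proj₂ nonLeaping) k 3≤k k≤n)

  qₖ≤1+qₖ₋₁ : ∀ {k} → 3 ≤ k → k ≤ n → q k ≤ suc (q (k ∸ 1))
  qₖ≤1+qₖ₋₁ {k} 3≤k k≤n = subst (q k ≤_) (+-comm (q (k ∸ 1)) 1)
    (proj₂ (proj₂ (proj₂ nonLeaping) k 3≤k k≤n))

  bₖ≡1+k∸qₖ : ∀ k → 3 ≤ k → b k ≡ suc k ∸ q k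
  bₖ≡1+k∸qₖ (suc zero) (s≤s ())
  bₖ≡1+k∸qₖ (suc (suc zero)) (s≤s (s≤s ()))
  bₖ≡1+k∸qₖ k@(suc (suc (suc _))) _ = cong (_∸ q k) (+-comm k 1)

  bₖ<k : ∀ {k} → 3 ≤ k → k ≤ n → b k < k
  bₖ<k {k@(suc _)} 3≤k k≤n rewrite bₖ≡1+k∸qₖ k 3≤k = s≤s (∸-monoʳ-≤ (suc k) (2≤qₖ 3≤k k≤n))

  bₖ≤k : ∀ {k} → 2 ≤ k → k ≤ n → b k ≤ k
  bₖ≤k {suc zero} (s≤s ()) _
  bₖ≤k {suc (suc zero)} _ _ = ≤-refl
  bₖ≤k {suc (suc (suc _))} _ k≤n = <⇒≤ (bₖ<k (s≤s (s≤s (s≤s z≤n))) k≤n)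

  bₖ≤bₖ₊₁ : ∀ {k} → 2 ≤ k → suc k ≤ n → b k ≤ b (suc k)
  bₖ≤bₖ₊₁ {suc zero} (s≤s ()) _
  bₖ≤bₖ₊₁ {suc (suc zero)} _ 3≤n =
    ∸-monoʳ-≤ 4 (subst (λ t → q 3 ≤ suc t) (proj₁ (proj₂ nonLeaping)) (qₖ≤1+qₖ₋₁ ≤-refl 3≤n))
  bₖ≤bₖ₊₁ {k@(suc (suc (suc _)))} _ k<n
    rewrite bₖ≡1+k∸qₖ k (s≤s (s≤s (s≤s z≤n))) | bₖ≡1+k∸qₖ (suc k) (s≤s (s≤s (s≤s z≤n))) =
    ∸-monoʳ-≤ (suc (suc k)) (qₖ≤1+qₖ₋₁ (s≤s (s≤s (s≤s z≤n))) k<n)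

  b-mono : ∀ {j k} → 2 ≤ j → j ≤ k → k ≤ n → b j ≤ b k
  b-mono {j} 2≤j j≤k = go (≤⇒≤′ j≤k)
    where
    go : ∀ {k} → j ≤′ k → k ≤ n → b j ≤ b k
    go ≤′-refl _ = ≤-refl
    go (≤′-step j≤′k) k<n = ≤-trans (go j≤′k (<⇒≤ k<n)) (bₖ≤bₖ₊₁ (≤-trans 2≤j (≤′⇒≤ j≤′k)) k<n)

  2≤bₖ : ∀ {k} → 2 ≤ k → k ≤ n → 2 ≤ b k
  2≤bₖ 2≤k k≤n = b-mono ≤-refl 2≤k k≤n

module Neighborhoods {n : ℕ} {q a : ℕ → ℕ} (nonLeaping : NonLeaping n q)
                     (neighborhoodSeq : NeighborhoodSeq n q a) where

  open BSeq nonLeaping public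

  infix 4 _∈W_
  _∈W_ : ℕ → ℕ → Set
  x ∈W v = InW q a x v

  a<b : ∀ {v} → 2 ≤ v → v ≤ n → a v < b v
  a<b {suc zero} (s≤s ()) _
  a<b {suc (suc zero)} _ _ = subst (_< 2) (sym (proj₁ neighborhoodSeq)) ≤-refl
  a<b {suc (suc (suc _))} _ v≤n = proj₂ (proj₂ neighborhoodSeq _ (s≤s (s≤s (s≤s z≤n))) v≤n)

  a∈W-pred : ∀ {v} → 3 ≤ v → v ≤ n → a v ∈W v ∸ 1
  a∈W-pred 3≤v v≤n = proj₁ (proj₂ neighborhoodSeq _ 3≤v v≤n)

  a∈W : ∀ {v} → 2 ≤ v → a v ∈W v
  a∈W {suc zero} (s≤s ())
  a∈W {suc (suc zero)} _ = proj₁ neighborhoodSeq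
  a∈W {suc (suc (suc _))} _ = inj₁ refl

  ∈W⇒2≤ : ∀ {x v} → x ∈W v → 2 ≤ v
  ∈W⇒2≤ {v = suc (suc zero)} _ = ≤-refl
  ∈W⇒2≤ {v = suc (suc (suc _))} _ = s≤s (s≤s z≤n)

  ∈W-cases : ∀ {x v} → x ∈W v → x ≡ a v ⊎ (b v ≤ x × x < v)
  ∈W-cases {v = suc (suc zero)} x≡1 = inj₁ (trans x≡1 (sym (proj₁ neighborhoodSeq)))
  ∈W-cases {v = suc (suc (suc _))} x∈W = x∈W

  ∈W-interval : ∀ {x v} → 2 ≤ v → b v ≤ x → x < v → x ∈W v
  ∈W-interval {v = suc zero} (s≤s ()) _ _
  ∈W-interval {v = suc (suc zero)} _ 2≤x x<2 = ⊥-elim (<⇒≱ x<2 2≤x)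
  ∈W-interval {v = suc (suc (suc _))} _ b≤x x<v = inj₂ (b≤x , x<v)

  ∈W⇒< : ∀ {x v} → v ≤ n → x ∈W v → x < v
  ∈W⇒< v≤n x∈W with ∈W-cases x∈W
  ... | inj₁ refl = <-≤-trans (a<b (∈W⇒2≤ x∈W) v≤n) (bₖ≤k (∈W⇒2≤ x∈W) v≤n)
  ... | inj₂ (_ , x<v) = x<v

  ∈W⇒1≤ : ∀ {x v} → v ≤ n → x ∈W v → 1 ≤ x
  ∈W⇒1≤ {v = suc (suc zero)} _ refl = ≤-refl
  ∈W⇒1≤ {v = suc (suc (suc _))} v≤n (inj₁ refl) = ∈W⇒1≤ (<⇒≤ v≤n) (a∈W-pred (s≤s (s≤s (s≤s z≤n))) v≤n)
  ∈W⇒1≤ {v = suc (suc (suc _))} v≤n (inj₂ (b≤x , _)) = ≤-trans (s≤s z≤n) (≤-trans (2≤bₖ (s≤s (s≤s z≤n)) v≤n) b≤x)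

  ∈W-clique : ∀ v {x y} → v ≤ n → x ∈W v → y ∈W v → x < y → x ∈W y
  ∈W-clique (suc (suc zero)) _ refl refl x<y = ⊥-elim (<-irrefl refl x<y)
  ∈W-clique (suc (suc (suc _))) _ (inj₁ refl) (inj₁ refl) x<y = ⊥-elim (<-irrefl refl x<y)
  ∈W-clique (suc (suc (suc _))) v≤n (inj₂ (b≤x , _)) (inj₁ refl) x<y =
    ⊥-elim (<-asym x<y (<-≤-trans (a<b (s≤s (s≤s z≤n)) v≤n) b≤x))
  ∈W-clique (suc (suc (suc _))) {y = y} v≤n (inj₂ (b≤x , _)) (inj₂ (b≤y , y<v)) x<y =
    ∈W-interval 2≤y (≤-trans (b-mono 2≤y (<⇒≤ y<v) v≤n) b≤x) x<y
    where
    2≤y : 2 ≤ y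
    2≤y = ≤-trans (2≤bₖ (s≤s (s≤s z≤n)) v≤n) b≤y
  ∈W-clique (suc (suc (suc v))) v≤n (inj₁ refl) (inj₂ (b≤y , y<v)) x<y =
    [ (λ y<v-1 → ∈W-clique (suc (suc v)) (<⇒≤ v≤n) a∈W-v-1
                   (∈W-interval (s≤s (s≤s z≤n)) (≤-trans (bₖ≤bₖ₊₁ (s≤s (s≤s z≤n)) v≤n) b≤y) y<v-1) x<y)
    , (λ y≡v-1 → subst (a (3 + v) ∈W_) (sym y≡v-1) a∈W-v-1)
    ]′ (m≤n⇒m<n∨m≡n (≤-pred y<v))
    where
    a∈W-v-1 : a (3 + v) ∈W 2 + v
    a∈W-v-1 = a∈W-pred (s≤s (s≤s (s≤s z≤n))) v≤n

  a∈W-above-b : ∀ {v x} → 2 ≤ v → v ≤ n → b v ≤ x → x < v → a v ∈W x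
  a∈W-above-b {v} 2≤v v≤n b≤x x<v =
    ∈W-clique v v≤n (a∈W 2≤v) (∈W-interval 2≤v b≤x x<v) (<-≤-trans (a<b 2≤v v≤n) b≤x)

module Graph {n : ℕ} {q a : ℕ → ℕ} (nonLeaping : NonLeaping n q)
             (neighborhoodSeq : NeighborhoodSeq n q a) where

  open Neighborhoods nonLeaping neighborhoodSeq public

  infix 4 _~_
  _~_ : ℕ → ℕ → Set
  _~_ = Adj n q a

  Vertex : ℕ → Set
  Vertex x = 1 ≤ x × x ≤ n

  ∈W⇒~ : ∀ {x v} → v ≤ n → x ∈W v → x ~ v
  ∈W⇒~ v≤n x∈W = inj₁ (v≤n , x∈W)

  ~-sym : ∀ {x y} → x ~ y → y ~ x
  ~-sym (inj₁ e) = inj₂ e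
  ~-sym (inj₂ e) = inj₁ e

  ~-down : ∀ {x y} → x ~ y → y < x → x ≤ n × y ∈W x
  ~-down (inj₁ (y≤n , x∈W)) y<x = ⊥-elim (<-asym y<x (∈W⇒< y≤n x∈W))
  ~-down (inj₂ e) _ = e

  ∈W⇒vertex : ∀ {x v} → v ≤ n → x ∈W v → Vertex x
  ∈W⇒vertex v≤n x∈W = ∈W⇒1≤ v≤n x∈W , <⇒≤ (<-≤-trans (∈W⇒< v≤n x∈W) v≤n)

  ~⇒vertices : ∀ {x y} → x ~ y → Vertex x × Vertex y
  ~⇒vertices (inj₁ (y≤n , x∈W)) = ∈W⇒vertex y≤n x∈W , ≤-trans (s≤s z≤n) (∈W⇒2≤ x∈W) , y≤n
  ~⇒vertices (inj₂ (x≤n , y∈W)) = (≤-trans (s≤s z≤n) (∈W⇒2≤ y∈W) , x≤n) , ∈W⇒vertex x≤n y∈W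

  ~-irrefl : ∀ {x y} → x ~ y → x ≢ y
  ~-irrefl (inj₁ (y≤n , x∈W)) x≡y = <⇒≢ (∈W⇒< y≤n x∈W) x≡y
  ~-irrefl (inj₂ (x≤n , y∈W)) x≡y = <⇒≢ (∈W⇒< x≤n y∈W) (sym x≡y)

  ∈W-adjacent-or-equal : ∀ {v x y} → v ≤ n → x ∈W v → y ∈W v → x ≡ y ⊎ x ~ y
  ∈W-adjacent-or-equal {v} {x} {y} v≤n x∈W y∈W with <-cmp x y
  ... | tri< x<y _ _ = inj₂ (∈W⇒~ (proj₂ (∈W⇒vertex v≤n y∈W)) (∈W-clique v v≤n x∈W y∈W x<y))
  ... | tri≈ _ x≡y _ = inj₁ x≡y
  ... | tri> _ _ y<x = inj₂ (~-sym (∈W⇒~ (proj₂ (∈W⇒vertex v≤n x∈W)) (∈W-clique v v≤n y∈W x∈W y<x)))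

  ShortcutThroughW : ℕ → ℕ → ℕ → Set
  ShortcutThroughW w u m = ∃[ x ] x ∈W w × ∃[ m′ ] m′ < m × Walk _~_ x u m′

  shortcut-mono : ∀ {w u m₁ m₂} → m₁ ≤ m₂ → ShortcutThroughW w u m₁ → ShortcutThroughW w u m₂
  shortcut-mono m₁≤m₂ (x , x∈W , m′ , m′<m₁ , walk) = x , x∈W , m′ , <-≤-trans m′<m₁ m₁≤m₂ , walk

  -- If the walk first climbs to j > w, the part after j
  -- re-enters W_j at some x′; as w ∈ W_j too, either x′ ∈ W_w, or x′ = w, or w ~ x′, and in
  -- the last two cases we have a strictly shorter walk from w to u.
  shortcut : ∀ {w u m} → Acc _<_ m → u < w → Walk _~_ w u m → ShortcutThroughW w u m
  shortcut _ u<w here = ⊥-elim (<-irrefl refl u<w)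
  shortcut {w} (acc rec) u<w (step {j = j} w~j walk) with <-cmp j w
  ... | tri< j<w _ _ = j , proj₂ (~-down w~j j<w) , _ , ≤-refl , walk
  ... | tri≈ _ j≡w _ = ⊥-elim (~-irrefl w~j (sym j≡w))
  ... | tri> _ _ w<j with ~-down (~-sym w~j) w<j | shortcut (rec ≤-refl) (<-trans u<w w<j) walk
  ...   | j≤n , w∈W | x′ , x′∈W , m′ , m′<m , walk′ with <-cmp x′ w
  ...     | tri< x′<w _ _ = x′ , ∈W-clique j j≤n x′∈W w∈W x′<w , m′ , m<n⇒m<1+n m′<m , walk′
  ...     | tri≈ _ refl _ = shortcut-mono (m<n⇒m≤1+n m′<m) (shortcut (rec (m<n⇒m<1+n m′<m)) u<w walk′)
  ...     | tri> _ _ w<x′ = shortcut-mono (m≤n⇒m≤1+n m′<m) (shortcut (rec (s≤s m′<m)) u<w (step w~x′ walk′))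
    where
    w~x′ : w ~ x′
    w~x′ = ∈W⇒~ (<⇒≤ (<-≤-trans (∈W⇒< j≤n x′∈W) j≤n)) (∈W-clique j j≤n w∈W x′∈W w<x′)

module Distances {n : ℕ} {q a : ℕ → ℕ} {D : ℕ → ℕ → ℕ} (nonLeaping : NonLeaping n q)
                 (neighborhoodSeq : NeighborhoodSeq n q a)
                 (distMatrix : IsDistMatrix n (Adj n q a) D) where

  open Graph nonLeaping neighborhoodSeq public
  open Walks

  dist-walk : ∀ {i j} → Vertex i → Vertex j → Walk _~_ i j (D i j)
  dist-walk (1≤i , i≤n) (1≤j , j≤n) = proj₁ (distMatrix _ _ 1≤i i≤n 1≤j j≤n)

  dist-≤ : ∀ {i j m} → Vertex i → Vertex j → Walk _~_ i j m → D i j ≤ m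
  dist-≤ (1≤i , i≤n) (1≤j , j≤n) = proj₂ (distMatrix _ _ 1≤i i≤n 1≤j j≤n) _

  dist-refl : ∀ {i} → Vertex i → D i i ≡ 0
  dist-refl i-vertex = n≤0⇒n≡0 (dist-≤ i-vertex i-vertex here)

  dist-~ : ∀ {i j} → i ~ j → D i j ≡ 1
  dist-~ {i} {j} i~j = ≤-antisym (dist-≤ i-vertex j-vertex (step i~j here))
                         (walk-≥1 (~-irrefl i~j) (dist-walk i-vertex j-vertex))
    where
    i-vertex : Vertex i
    i-vertex = proj₁ (~⇒vertices i~j)
    j-vertex : Vertex j
    j-vertex = proj₂ (~⇒vertices i~j)

  dist-snoc : ∀ {i j l} → Vertex i → j ~ l → D i l ≤ suc (D i j)
  dist-snoc i-vertex j~l =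
    dist-≤ i-vertex (proj₂ (~⇒vertices j~l)) (snoc (dist-walk i-vertex (proj₁ (~⇒vertices j~l))) j~l)

  dist-≥2 : ∀ {i j} → Vertex i → Vertex j → i ≢ j → ¬ i ~ j → 2 ≤ D i j
  dist-≥2 i-vertex j-vertex i≢j ¬i~j = walk-≥2 i≢j ¬i~j (dist-walk i-vertex j-vertex)

  closer-∈W : ∀ {u w} → Vertex u → w ≤ n → u < w → ∃[ x ] x ∈W w × D u x < D u w
  closer-∈W {u} {w} u-vertex w≤n u<w =
    closer (shortcut (<-wellFounded _) u<w (reverse ~-sym (dist-walk u-vertex w-vertex)))
    where
    w-vertex : Vertex w
    w-vertex = ≤-trans (proj₁ u-vertex) (<⇒≤ u<w) , w≤n
    closer : ShortcutThroughW w u (D u w) → ∃[ x ] x ∈W w × D u x < D u w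
    closer (x , x∈W , _ , m′<dist , walk) =
      x , x∈W , ≤-<-trans (dist-≤ u-vertex (∈W⇒vertex w≤n x∈W) (reverse ~-sym walk)) m′<dist

  dist-∈W-≤ : ∀ {u w y} → Vertex u → w ≤ n → u < w → y ∈W w → D u y ≤ D u w
  dist-∈W-≤ u-vertex w≤n u<w y∈W with closer-∈W u-vertex w≤n u<w
  ... | x , x∈W , closer with ∈W-adjacent-or-equal w≤n y∈W x∈W
  ...   | inj₁ refl = <⇒≤ closer
  ...   | inj₂ y~x = ≤-trans (dist-snoc u-vertex (~-sym y~x)) closer

  dist-via-a : ∀ {u v} → 2 ≤ v → v ≤ n → Vertex u → u < b v → D u v ≡ suc (D u (a v))
  dist-via-a {u} {v} 2≤v v≤n u-vertex u<b = ≤-antisym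
    (dist-snoc u-vertex (∈W⇒~ v≤n (a∈W 2≤v)))
    (closest (closer-∈W u-vertex v≤n (<-≤-trans u<b (bₖ≤k 2≤v v≤n))))
    where
    closest : ∃[ x ] x ∈W v × D u x < D u v → suc (D u (a v)) ≤ D u v
    closest (x , x∈W , closer) with ∈W-cases x∈W
    ... | inj₁ refl = closer
    ... | inj₂ (b≤x , x<v) = ≤-<-trans
      (dist-∈W-≤ u-vertex (<⇒≤ (<-≤-trans x<v v≤n)) (<-≤-trans u<b b≤x) (a∈W-above-b 2≤v v≤n b≤x x<v))
      closer

  bvec-by : ∀ {k h x₁ x₂ x₃ x₄} →
            D h k ≡ x₁ → D h (a k) ≡ x₂ → D h (k ∸ 1) ≡ x₃ → D h (a (k ∸ 1)) ≡ x₄ →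
            bvec D a k h ≡ ((+ x₁ ℤ.- + x₂) ℤ.- + x₃) ℤ.+ + x₄
  bvec-by refl refl refl refl = refl

  module Column {k : ℕ} (3≤k+1 : 3 ≤ suc k) (k+1≤n : suc k ≤ n) where

    2≤k : 2 ≤ k
    2≤k = ≤-pred 3≤k+1

    2≤k+1 : 2 ≤ suc k
    2≤k+1 = m≤n⇒m≤1+n 2≤k

    k≤n : k ≤ n
    k≤n = <⇒≤ k+1≤n

    b-k≤b-k+1 : b k ≤ b (suc k)
    b-k≤b-k+1 = bₖ≤bₖ₊₁ 2≤k k+1≤n

    b-k+1≤k : b (suc k) ≤ k
    b-k+1≤k = ≤-pred (bₖ<k 3≤k+1 k+1≤n)

    k∈W-k+1 : k ∈W suc k
    k∈W-k+1 = ∈W-interval 2≤k+1 b-k+1≤k ≤-refl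

    a-k+1∈W-k : a (suc k) ∈W k
    a-k+1∈W-k = a∈W-pred 3≤k+1 k+1≤n

    k+1-vertex : Vertex (suc k)
    k+1-vertex = s≤s z≤n , k+1≤n

    bvec-below : ∀ {h} → Vertex h → h < b k → bvec D a (suc k) h ≡ + 0
    bvec-below {h} h-vertex h<b = trans
      (bvec-by (dist-via-a 2≤k+1 k+1≤n h-vertex (<-≤-trans h<b b-k≤b-k+1)) refl
               (dist-via-a 2≤k k≤n h-vertex h<b) refl)
      ([1+x]-x-[1+y]+y≡0 (+ D h (a (suc k))) (+ D h (a k)))

    bvec-between : ∀ {h} → Vertex h → b k ≤ h → h < b (suc k) → bvec D a (suc k) h ≡ + 1
    bvec-between {h} h-vertex b≤h h<b = trans
      (bvec-by (dist-via-a 2≤k+1 k+1≤n h-vertex h<b) refl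
               (dist-~ (∈W⇒~ k≤n (∈W-interval 2≤k b≤h h<k)))
               (dist-~ (~-sym (∈W⇒~ (proj₂ h-vertex) (a∈W-above-b 2≤k k≤n b≤h h<k)))))
      ([1+x]-x-1+1≡1 (+ D h (a (suc k))))
      where
      h<k : h < k
      h<k = <-≤-trans h<b b-k+1≤k

    bvec-above : ∀ {h} → b (suc k) ≤ h → h < k → bvec D a (suc k) h ≡ + 0
    bvec-above {h} b≤h h<k = bvec-by
      (dist-~ (∈W⇒~ k+1≤n (∈W-interval 2≤k+1 b≤h (m<n⇒m<1+n h<k))))
      (dist-~ (~-sym (∈W⇒~ h≤n (∈W-clique k k≤n a-k+1∈W-k h∈W-k (<-≤-trans (a<b 2≤k+1 k+1≤n) b≤h)))))
      (dist-~ (∈W⇒~ k≤n h∈W-k))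
      (dist-~ (~-sym (∈W⇒~ h≤n (a∈W-above-b 2≤k k≤n b-k≤h h<k))))
      where
      b-k≤h : b k ≤ h
      b-k≤h = ≤-trans b-k≤b-k+1 b≤h
      h∈W-k : h ∈W k
      h∈W-k = ∈W-interval 2≤k b-k≤h h<k
      h≤n : h ≤ n
      h≤n = <⇒≤ (<-≤-trans h<k k≤n)

    bvec-pred : bvec D a (suc k) k ≡ + 1
    bvec-pred = bvec-by
      (dist-~ (∈W⇒~ k+1≤n k∈W-k+1))
      (dist-~ (~-sym (∈W⇒~ k≤n a-k+1∈W-k)))
      (dist-refl (≤-trans (s≤s z≤n) 2≤k , k≤n))
      (dist-~ (~-sym (∈W⇒~ k≤n (a∈W 2≤k))))

    bvec-diag-≡ : a k ≡ a (suc k) → bvec D a (suc k) (suc k) ≡ -[1+ 0 ]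
    bvec-diag-≡ a-k≡a-k+1 = bvec-by
      (dist-refl k+1-vertex)
      (dist-~ (~-sym (∈W⇒~ k+1≤n (a∈W 2≤k+1))))
      (dist-~ (~-sym (∈W⇒~ k+1≤n k∈W-k+1)))
      (trans (cong (D (suc k)) a-k≡a-k+1) (dist-~ (~-sym (∈W⇒~ k+1≤n (a∈W 2≤k+1)))))

    -- k+1 — k — a_k is a shortest path: a_k ∉ W_{k+1}, being neither a_{k+1} nor ≥ b_{k+1}.
    dist-k+1-a-k : a k < a (suc k) → D (suc k) (a k) ≡ 2
    dist-k+1-a-k a-k<a-k+1 = ≤-antisym
      (dist-≤ k+1-vertex a-k-vertex (step (~-sym (∈W⇒~ k+1≤n k∈W-k+1)) (step (~-sym a-k~k) here)))
      (dist-≥2 k+1-vertex a-k-vertex (λ k+1≡a-k → <-irrefl (sym k+1≡a-k) a-k<k+1) not-adjacent)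
      where
      a-k~k : a k ~ k
      a-k~k = ∈W⇒~ k≤n (a∈W 2≤k)
      a-k-vertex : Vertex (a k)
      a-k-vertex = proj₁ (~⇒vertices a-k~k)
      a-k<k+1 : a k < suc k
      a-k<k+1 = m<n⇒m<1+n (∈W⇒< k≤n (a∈W 2≤k))
      not-adjacent : ¬ suc k ~ a k
      not-adjacent k+1~a-k with ∈W-cases (proj₂ (~-down k+1~a-k a-k<k+1))
      ... | inj₁ a-k≡a-k+1 = <-irrefl a-k≡a-k+1 a-k<a-k+1
      ... | inj₂ (b≤a-k , _) = <⇒≱ (<-≤-trans (a<b 2≤k k≤n) b-k≤b-k+1) b≤a-k

    bvec-diag-< : a k < a (suc k) → bvec D a (suc k) (suc k) ≡ + 0
    bvec-diag-< a-k<a-k+1 = bvec-by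
      (dist-refl k+1-vertex)
      (dist-~ (~-sym (∈W⇒~ k+1≤n (a∈W 2≤k+1))))
      (dist-~ (~-sym (∈W⇒~ k+1≤n k∈W-k+1)))
      (dist-k+1-a-k a-k<a-k+1)

corollary2p12 : (n : ℕ) → 2 ≤ n → (q a : ℕ → ℕ) → (D : ℕ → ℕ → ℕ) →
    NonLeaping n q → NeighborhoodSeq n q a →
    IsDistMatrix n (Adj n q a) D →
    ∀ k → 3 ≤ k → k ≤ n → ∀ h → 1 ≤ h → h ≤ k →
      (h < bseq q (k ∸ 1) → bvec D a k h ≡ + 0) ×
      (bseq q (k ∸ 1) ≤ h → h < bseq q k → bvec D a k h ≡ + 1) ×
      (bseq q k ≤ h → h < k ∸ 1 → bvec D a k h ≡ + 0) ×
      (h ≡ k ∸ 1 → bvec D a k h ≡ + 1) ×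
      (h ≡ k → a (k ∸ 1) ≡ a k → bvec D a k h ≡ -[1+ 0 ]) ×
      (h ≡ k → a (k ∸ 1) < a k → bvec D a k h ≡ + 0)
corollary2p12 n _ q a D nonLeaping neighborhoodSeq distMatrix (suc k) 3≤k+1 k+1≤n h 1≤h h≤k+1 =
  bvec-below h-vertex ,
  bvec-between h-vertex ,
  bvec-above ,
  (λ { refl → bvec-pred }) ,
  (λ { refl → bvec-diag-≡ }) ,
  (λ { refl → bvec-diag-< })
  where
  open Distances nonLeaping neighborhoodSeq distMatrix
  open Column 3≤k+1 k+1≤n
  h-vertex : Vertex h
  h-vertex = 1≤h , ≤-trans h≤k+1 k+1≤n
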